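{- Let $i\geq1$ and $j\geq0$ be integers with $i\leq n$. Then $\mathfrak{BP}(d,\underline{C};\underline{w})$ is $(i+j-1)$-feasible if and only if $\mathfrak{BP}(d,\underline{C}^{\geq i};\underline{w}^{\geq i})$ is $j$-feasible.
   Context: Partitioning problem: for $m\geq1$, integers $v_1\geq\cdots\geq v_m\geq0$, positive integer $d$ and integers $D_1\geq\cdots\geq D_m$, let $\mathcal{B}$ be the multiset with $d$ balls of weight $v_t$ for each $t=1,\dots,m$. An assignment is a partition $\mathcal{B}=\mathcal{B}_1\sqcup\cdots\sqcup\mathcal{B}_m$ with each $\mathcal{B}_t$ containing exactly $d$ balls; $w(\mathcal{B}_t)$ denotes its total weight. $\mathfrak{BP}(d,\underline{D};\underline{v})$ is $k$-feasible if some assignment satisfies $w(\mathcal{B}_t)\leq D_t$ for all $t=k+1,\dots,m$ (so $0$-feasible means feasible). Here $\underline{w}=(w_1\geq\cdots\geq w_n\geq0)$, $\underline{C}=(C_1\geq\cdots\geq C_n)$, and the truncations are $\underline{w}^{\geq i}=(w_i,\dots,w_n)$, $\underline{C}^{\geq i}=(C_i,\dots,C_n)$, giving a problem with $n-i+1$ bins. -}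

module Defs where

open import Data.Nat using (ℕ; zero; suc; _+_; _∸_; _≤_; _<_; s≤s; z≤n)
open import Data.Nat.Properties
open import Data.Fin using (Fin; toℕ; fromℕ<)
open import Data.Fin.Properties using (toℕ<n)
open import Data.Integer using (ℤ; +_) renaming (_≤_ to _≤ℤ_)
open import Data.Product using (Σ; _×_)
open import Relation.Nullary using (does)
open import Data.Bool using (if_then_else_)
open import Relation.Binary.PropositionalEquality using (_≡_)

sumFin : (n : ℕ) → (Fin n → ℕ) → ℕ
sumFin zero    f = 0
sumFin (suc n) f = f Fin.zero + sumFin n (λ t → f (Fin.suc t))
  where import Data.Fin as Fin

NonIncreasingℕ : {n : ℕ} → (Fin n → ℕ) → Set
NonIncreasingℕ {n} v = (s t : Fin n) → toℕ s ≤ toℕ t → v t ≤ v s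

NonIncreasingℤ : {n : ℕ} → (Fin n → ℤ) → Set
NonIncreasingℤ {n} D = (s t : Fin n) → toℕ s ≤ toℕ t → D t ≤ℤ D s

-- An assignment of the multiset B (d balls of weight v s for each ball-type s : Fin m)
-- into m bins of exactly d balls each: bin t, slot k holds a ball of type f t k,
-- and each type s is used exactly d times overall.
countType : (m d : ℕ) → (Fin m → Fin d → Fin m) → Fin m → ℕ
countType m d f s =
  sumFin m (λ t → sumFin d (λ k → if does (f t k Data.Fin.≟ s) then 1 else 0))
  where import Data.Fin

record Assignment (m d : ℕ) : Set where
  field
    ballType : Fin m → Fin d → Fin m
    exact    : (s : Fin m) → countType m d ballType s ≡ d

binWeight : {m d : ℕ} → (Fin m → ℕ) → Assignment m d → Fin m → ℕ
binWeight {m} {d} v A t = sumFin d (λ k → v (Assignment.ballType A t k))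

-- BP(d, D; v) is k-feasible: some assignment with w(B_t) ≤ D_t for all t = k+1..m
-- (1-based), i.e. for all 0-based t with k ≤ toℕ t.
Feasible : (k m d : ℕ) → (Fin m → ℤ) → (Fin m → ℕ) → Set
Feasible k m d D v =
  Σ (Assignment m d) λ A → (t : Fin m) → k ≤ toℕ t → + (binWeight v A t) ≤ℤ D t

-- truncation x^{≥ i} = (x_i, ..., x_n) (1-based i with 1 ≤ i ≤ n), n - i + 1 entries
private
  truncBound : (n i t : ℕ) → 1 ≤ i → i ≤ n → t < suc (n ∸ i) → (i ∸ 1) + t < n
  truncBound n (suc i) t _ i≤n (s≤s t≤) =
    let step : i + t ≤ i + (n ∸ suc i)
        step = +-monoʳ-≤ i t≤
        eq : suc (i + (n ∸ suc i)) ≡ n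
        eq = m+[n∸m]≡n i≤n
    in Relation.Binary.PropositionalEquality.subst (λ x → suc (i + t) ≤ x) eq (s≤s step)
    where import Relation.Binary.PropositionalEquality

truncate : {A : Set} (n i : ℕ) → 1 ≤ i → i ≤ n → (Fin n → A) → Fin (suc (n ∸ i)) → A
truncate n i 1≤i i≤n x t = x (fromℕ< (truncBound n i (toℕ t) 1≤i i≤n (toℕ<n t)))

-- Feasibility that ignores bin 1 reduces to the problem without bin 1 and without the
-- d heaviest balls. Backwards, put those d balls into the unconstrained bin 1. Forwards,
-- while bin 1 holds a ball that is not heaviest, exchange it with a heaviest ball from a
-- later bin: that bin gets no heavier since w is nonincreasing. Once bin 1 holds
-- exactly the heaviest balls, the other bins assign the truncated problem. Applying
-- this i - 1 times gives the theorem.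
module Submission where

open import Defs
open import Data.Nat using (ℕ; suc; _+_; _∸_; _≤_)
open import Data.Fin using (Fin)
open import Data.Integer using (ℤ)
open import Function.Bundles using (_⇔_)

open import Data.Nat using (zero; _<_; z≤n; s≤s; s≤s⁻¹; z<s)
open import Data.Nat.Properties hiding (_≟_)
open import Data.Nat.Tactic.RingSolver using (solve)
open import Algebra.Properties.CommutativeSemigroup +-commutativeSemigroup using (xy∙z≈xz∙y)
open import Data.Fin as Fin using (toℕ; _≟_; punchOut)
open import Data.Fin.Properties using (toℕ-fromℕ<; toℕ-injective; punchIn-punchOut)
open import Data.Vec.Functional using (updateAt)
import Data.Integer as ℤ
import Data.Integer.Properties as ℤ
open import Data.List using (_∷_; [])
open import Data.Product using (Σ-syntax; ∃; ∃₂; _×_; _,_)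
open import Data.Bool using (true; false; if_then_else_)
open import Relation.Nullary using (does; yes; no)
open import Relation.Binary.PropositionalEquality
open import Function using (_∘_; const; id)
open import Function.Bundles using (mk⇔)
open import Function.Properties.Equivalence using () renaming (trans to ⇔-trans)

+-transfer : ∀ {a b c d x y : ℕ} → a + x ≡ b + y → c + y ≡ d + x → a + c ≡ b + d
+-transfer {a} {b} {c} {d} {x} {y} e e′ = +-cancelʳ-≡ (x + y) (a + c) (b + d) (begin
  a + c + (x + y)   ≡⟨ solve (a ∷ c ∷ x ∷ y ∷ []) ⟩
  (a + x) + (c + y) ≡⟨ cong₂ _+_ e e′ ⟩
  (b + y) + (d + x) ≡⟨ solve (b ∷ d ∷ x ∷ y ∷ []) ⟩
  b + d + (x + y)   ∎)
  where open ≡-Reasoning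

sumFin-cong : ∀ n {f g : Fin n → ℕ} → (∀ k → f k ≡ g k) → sumFin n f ≡ sumFin n g
sumFin-cong zero    f≗g = refl
sumFin-cong (suc n) f≗g = cong₂ _+_ (f≗g Fin.zero) (sumFin-cong n (f≗g ∘ Fin.suc))

sumFin-mono-≤ : ∀ n {f g : Fin n → ℕ} → (∀ k → f k ≤ g k) → sumFin n f ≤ sumFin n g
sumFin-mono-≤ zero    f≤g = z≤n
sumFin-mono-≤ (suc n) f≤g = +-mono-≤ (f≤g Fin.zero) (sumFin-mono-≤ n (f≤g ∘ Fin.suc))

sumFin-zeros : ∀ n → sumFin n (const 0) ≡ 0
sumFin-zeros zero    = refl
sumFin-zeros (suc n) = sumFin-zeros n

sumFin-ones : ∀ n → sumFin n (const 1) ≡ n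
sumFin-ones zero    = refl
sumFin-ones (suc n) = cong suc (sumFin-ones n)

sumFin≤n : ∀ n {f : Fin n → ℕ} → (∀ k → f k ≤ 1) → sumFin n f ≤ n
sumFin≤n n {f} f≤1 = subst (sumFin n f ≤_) (sumFin-ones n) (sumFin-mono-≤ n f≤1)

sumFin≡0⇒≡0 : ∀ n (f : Fin n → ℕ) → sumFin n f ≡ 0 → ∀ k → f k ≡ 0
sumFin≡0⇒≡0 (suc n) f Σ≡0 Fin.zero    = m+n≡0⇒m≡0 (f Fin.zero) Σ≡0
sumFin≡0⇒≡0 (suc n) f Σ≡0 (Fin.suc k) = sumFin≡0⇒≡0 n (f ∘ Fin.suc) (m+n≡0⇒n≡0 (f Fin.zero) Σ≡0) k

sumFin>0⇒∃>0 : ∀ n (f : Fin n → ℕ) → 0 < sumFin n f → ∃ λ k → 0 < f k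
sumFin>0⇒∃>0 (suc n) f Σ>0 with f Fin.zero in f₀≡
... | suc _ = Fin.zero , subst (0 <_) (sym f₀≡) z<s
... | zero  = let k , fk>0 = sumFin>0⇒∃>0 n (f ∘ Fin.suc) Σ>0 in Fin.suc k , fk>0

sumFin<n⇒∃≡0 : ∀ n (f : Fin n → ℕ) → sumFin n f < n → ∃ λ k → f k ≡ 0
sumFin<n⇒∃≡0 (suc n) f Σ<n with f Fin.zero in f₀≡
... | zero  = Fin.zero , f₀≡
... | suc x = let k , fk≡0 = sumFin<n⇒∃≡0 n (f ∘ Fin.suc) rest<n in Fin.suc k , fk≡0
  where
    rest<n : sumFin n (f ∘ Fin.suc) < n
    rest<n = ≤-trans (s≤s (m≤n+m _ x)) (s≤s⁻¹ Σ<n)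

sumFin≡n⇒≡1 : ∀ n (f : Fin n → ℕ) → (∀ k → f k ≤ 1) → sumFin n f ≡ n → ∀ k → f k ≡ 1
sumFin≡n⇒≡1 (suc n) f f≤1 Σ≡n = λ where
    Fin.zero    → head≡1
    (Fin.suc k) → sumFin≡n⇒≡1 n (f ∘ Fin.suc) (f≤1 ∘ Fin.suc) rest≡n k
  where
    head≡1 : f Fin.zero ≡ 1
    head≡1 = ≤-antisym (f≤1 Fin.zero) (+-cancelʳ-≤ n 1 (f Fin.zero)
      (subst (_≤ f Fin.zero + n) Σ≡n (+-monoʳ-≤ (f Fin.zero) (sumFin≤n n (f≤1 ∘ Fin.suc)))))
    rest≡n : sumFin n (f ∘ Fin.suc) ≡ n
    rest≡n = suc-injective (trans (cong (_+ sumFin n (f ∘ Fin.suc)) (sym head≡1)) Σ≡n)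

sumFin-updateAt : ∀ n {A : Set} (F : A → ℕ) (xs : Fin n → A) p {g : A → A} {x y : ℕ}
                → F (g (xs p)) + y ≡ F (xs p) + x
                → sumFin n (F ∘ updateAt xs p g) + y ≡ sumFin n (F ∘ xs) + x
sumFin-updateAt (suc n) F xs Fin.zero {g} {x} {y} e = begin
  F (g (xs Fin.zero)) + S + y ≡⟨ xy∙z≈xz∙y _ S y ⟩
  F (g (xs Fin.zero)) + y + S ≡⟨ cong (_+ S) e ⟩
  F (xs Fin.zero) + x + S     ≡⟨ xy∙z≈xz∙y _ x S ⟩
  F (xs Fin.zero) + S + x     ∎
  where
    open ≡-Reasoning
    S : ℕ
    S = sumFin n (F ∘ xs ∘ Fin.suc)
sumFin-updateAt (suc n) F xs (Fin.suc p) {x = x} {y} e = begin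
  F (xs Fin.zero) + S′ + y   ≡⟨ +-assoc (F (xs Fin.zero)) S′ y ⟩
  F (xs Fin.zero) + (S′ + y) ≡⟨ cong (F (xs Fin.zero) +_) (sumFin-updateAt n F (xs ∘ Fin.suc) p e) ⟩
  F (xs Fin.zero) + (S + x)  ≡⟨ +-assoc (F (xs Fin.zero)) S x ⟨
  F (xs Fin.zero) + S + x    ∎
  where
    open ≡-Reasoning
    S S′ : ℕ
    S  = sumFin n (F ∘ xs ∘ Fin.suc)
    S′ = sumFin n (F ∘ updateAt (xs ∘ Fin.suc) p _)

updateAt-pointwise : ∀ {A : Set} {n} (R : A → A → Set) → (∀ x → R x x)
                   → (xs : Fin n → A) (p : Fin n) {g : A → A} → R (g (xs p)) (xs p)
                   → ∀ k → R (updateAt xs p g k) (xs k)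
updateAt-pointwise R R-refl xs Fin.zero    r Fin.zero    = r
updateAt-pointwise R R-refl xs Fin.zero    r (Fin.suc k) = R-refl (xs (Fin.suc k))
updateAt-pointwise R R-refl xs (Fin.suc p) r Fin.zero    = R-refl (xs Fin.zero)
updateAt-pointwise R R-refl xs (Fin.suc p) r (Fin.suc k) = updateAt-pointwise R R-refl (xs ∘ Fin.suc) p r k

indicator : ∀ {n} → Fin n → Fin n → ℕ
indicator x s = if does (x ≟ s) then 1 else 0

indicator≤1 : ∀ {n} (x s : Fin n) → indicator x s ≤ 1
indicator≤1 x s with does (x ≟ s)
... | true  = ≤-refl
... | false = z≤n

indicator>0⇒≡ : ∀ {n} {x s : Fin n} → 0 < indicator x s → x ≡ s
indicator>0⇒≡ {x = x} {s} with x ≟ s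
... | yes x≡s = const x≡s
... | no  _   = λ ()

indicator≡0⇒≢ : ∀ {n} {x s : Fin n} → indicator x s ≡ 0 → s ≢ x
indicator≡0⇒≢ {x = x} {s} with x ≟ s
... | yes _   = λ ()
... | no  x≢s = λ _ s≡x → x≢s (sym s≡x)

count : ∀ {n d} → (Fin d → Fin n) → Fin n → ℕ
count {d = d} row s = sumFin d (λ k → indicator (row k) s)

exchange : ∀ {A : Set} {m d} → (Fin (suc m) → Fin d → A) → Fin m → Fin d → Fin d
         → Fin (suc m) → Fin d → A
exchange f t a b Fin.zero    = updateAt (f Fin.zero) b (const (f (Fin.suc t) a))
exchange f t a b (Fin.suc u) = updateAt (f ∘ Fin.suc) t (λ row → updateAt row a (const (f Fin.zero b))) u

module _ {m d : ℕ} (f : Fin (suc m) → Fin d → Fin (suc m)) (t : Fin m) (a b : Fin d) where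

  private
    x y : Fin (suc m)
    x = f Fin.zero b
    y = f (Fin.suc t) a

  exchange-countFirst : ∀ s → count (exchange f t a b Fin.zero) s + indicator x s
                            ≡ count (f Fin.zero) s + indicator y s
  exchange-countFirst s =
    sumFin-updateAt d (λ z → indicator z s) (f Fin.zero) b {g = const y}
      (+-comm (indicator y s) (indicator x s))

  exchange-countType : ∀ s → countType (suc m) d (exchange f t a b) s ≡ countType (suc m) d f s
  exchange-countType s = +-transfer {x = indicator x s} {indicator y s} (exchange-countFirst s) tail
    where
      tail : sumFin m (λ u → count (exchange f t a b (Fin.suc u)) s) + indicator y s
           ≡ sumFin m (λ u → count (f (Fin.suc u)) s) + indicator x s
      tail = sumFin-updateAt m (λ row → count row s) (f ∘ Fin.suc) t
        {g = λ row → updateAt row a (const x)}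
        (sumFin-updateAt d (λ z → indicator z s) (f (Fin.suc t)) a {g = const x}
          (+-comm (indicator x s) (indicator y s)))

  exchange-countFirst-suc : y ≡ Fin.zero → indicator x Fin.zero ≡ 0
                          → count (exchange f t a b Fin.zero) Fin.zero ≡ suc (count (f Fin.zero) Fin.zero)
  exchange-countFirst-suc y≡0 ind-x≡0 = begin
    c′                        ≡⟨ +-identityʳ c′ ⟨
    c′ + 0                    ≡⟨ cong (c′ +_) ind-x≡0 ⟨
    c′ + indicator x Fin.zero ≡⟨ exchange-countFirst Fin.zero ⟩
    c + indicator y Fin.zero  ≡⟨ cong (λ z → c + indicator z Fin.zero) y≡0 ⟩
    c + 1                     ≡⟨ +-comm c 1 ⟩
    suc c                     ∎
    where
      open ≡-Reasoning
      c c′ : ℕ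
      c  = count (f Fin.zero) Fin.zero
      c′ = count (exchange f t a b Fin.zero) Fin.zero

  exchange-lighter : (w : Fin (suc m) → ℕ) → w x ≤ w y
                   → ∀ u k → w (exchange f t a b (Fin.suc u) k) ≤ w (f (Fin.suc u) k)
  exchange-lighter w x≤y =
    updateAt-pointwise (λ r r′ → ∀ k → w (r k) ≤ w (r′ k)) (λ _ _ → ≤-refl) (f ∘ Fin.suc) t
      (updateAt-pointwise (λ z z′ → w z ≤ w z′) (λ _ → ≤-refl) (f (Fin.suc t)) a x≤y)

open Assignment

exchangeBalls : ∀ {m d} → Assignment (suc m) d → Fin m → Fin d → Fin d → Assignment (suc m) d
exchangeBalls A t a b = record
  { ballType = exchange (ballType A) t a b
  ; exact    = λ s → trans (exchange-countType (ballType A) t a b s) (exact A s)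
  }

prependHeaviestBin : ∀ {m d} → Assignment m d → Assignment (suc m) d
prependHeaviestBin {m} {d} A = record { ballType = ballType′ ; exact = exact′ }
  where
    ballType′ : Fin (suc m) → Fin d → Fin (suc m)
    ballType′ Fin.zero    _ = Fin.zero
    ballType′ (Fin.suc t) k = Fin.suc (ballType A t k)

    exact′ : ∀ s → countType (suc m) d ballType′ s ≡ d
    exact′ Fin.zero    = trans (cong₂ _+_ (sumFin-ones d)
                           (trans (sumFin-cong m (λ _ → sumFin-zeros d)) (sumFin-zeros m)))
                           (+-identityʳ d)
    exact′ (Fin.suc s) = trans (cong (_+ countType m d (ballType A) s) (sumFin-zeros d)) (exact A s)

heaviestInFirstBin : ∀ {m d} → Assignment (suc m) d → ℕ
heaviestInFirstBin A = count (ballType A Fin.zero) Fin.zero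

module _ {m d : ℕ} (A : Assignment (suc m) d) where

  private
    heaviestInTail : ℕ
    heaviestInTail = sumFin m (λ t → count (ballType A (Fin.suc t)) Fin.zero)

  lightBallInFirstBin : heaviestInFirstBin A < d → ∃ λ b → indicator (ballType A Fin.zero b) Fin.zero ≡ 0
  lightBallInFirstBin = sumFin<n⇒∃≡0 d _

  heaviestBallInTail : heaviestInFirstBin A < d → ∃₂ λ t a → ballType A (Fin.suc t) a ≡ Fin.zero
  heaviestBallInTail h<d =
    let t , c>0 = sumFin>0⇒∃>0 m _ tail>0
        a , i>0 = sumFin>0⇒∃>0 d _ c>0
    in t , a , indicator>0⇒≡ i>0
    where
      tail>0 : 0 < heaviestInTail
      tail>0 = +-cancelˡ-< (heaviestInFirstBin A) 0 heaviestInTail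
        (subst₂ _<_ (sym (+-identityʳ _)) (sym (exact A Fin.zero)) h<d)

  module _ (full : heaviestInFirstBin A ≡ d) where

    firstBinAllHeaviest : ∀ k → ballType A Fin.zero k ≡ Fin.zero
    firstBinAllHeaviest k = indicator>0⇒≡ (subst (0 <_) (sym ind≡1) z<s)
      where
        ind≡1 : indicator (ballType A Fin.zero k) Fin.zero ≡ 1
        ind≡1 = sumFin≡n⇒≡1 d _ (λ k → indicator≤1 (ballType A Fin.zero k) Fin.zero) full k

    tailHasNoHeaviest : ∀ t k → Fin.zero ≢ ballType A (Fin.suc t) k
    tailHasNoHeaviest t k = indicator≡0⇒≢ (sumFin≡0⇒≡0 d _ (sumFin≡0⇒≡0 m _ tail≡0 t) k)
      where
        tail≡0 : heaviestInTail ≡ 0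
        tail≡0 = +-cancelˡ-≡ (heaviestInFirstBin A) heaviestInTail 0
          (trans (exact A Fin.zero) (trans (sym full) (sym (+-identityʳ _))))

    dropFirstBin : Assignment m d
    dropFirstBin = record { ballType = ballType′ ; exact = exact′ }
      where
        ballType′ : Fin m → Fin d → Fin m
        ballType′ t k = punchOut (tailHasNoHeaviest t k)

        exact′ : ∀ s → countType m d ballType′ s ≡ d
        exact′ s = trans (sym (cong₂ _+_ firstBin≡0 tail≡)) (exact A (Fin.suc s))
          where
            firstBin≡0 : count (ballType A Fin.zero) (Fin.suc s) ≡ 0
            firstBin≡0 = trans
              (sumFin-cong d (λ k → cong (λ z → indicator z (Fin.suc s)) (firstBinAllHeaviest k)))
              (sumFin-zeros d)
            tail≡ : sumFin m (λ t → count (ballType A (Fin.suc t)) (Fin.suc s)) ≡ countType m d ballType′ s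
            tail≡ = sumFin-cong m λ t → sumFin-cong d λ k →
              cong (λ z → indicator z (Fin.suc s)) (sym (punchIn-punchOut (tailHasNoHeaviest t k)))

    dropFirstBin-binWeight : ∀ (w : Fin (suc m) → ℕ) t
                           → binWeight (w ∘ Fin.suc) dropFirstBin t ≡ binWeight w A (Fin.suc t)
    dropFirstBin-binWeight w t = sumFin-cong d λ k → cong w (punchIn-punchOut (tailHasNoHeaviest t k))

module _ {m d : ℕ} (w : Fin (suc m) → ℕ) (w-anti : NonIncreasingℕ w) where

  TailNotHeavier : Assignment (suc m) d → Assignment (suc m) d → Set
  TailNotHeavier B A = ∀ t → binWeight w B (Fin.suc t) ≤ binWeight w A (Fin.suc t)

  -- r counts the heaviest balls outside the first bin.
  gatherHeaviest : ∀ r (A : Assignment (suc m) d) → heaviestInFirstBin A + r ≡ d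
                 → Σ[ B ∈ Assignment (suc m) d ] heaviestInFirstBin B ≡ d × TailNotHeavier B A
  gatherHeaviest zero    A h+0≡d = A , trans (sym (+-identityʳ _)) h+0≡d , λ _ → ≤-refl
  gatherHeaviest (suc r) A h+r≡d
    with lightBallInFirstBin A h<d | heaviestBallInTail A h<d
    where
      h<d : heaviestInFirstBin A < d
      h<d = subst (heaviestInFirstBin A <_) h+r≡d (m<m+n _ z<s)
  ... | b , ind-x≡0 | t , a , y≡0 =
    let B , full , B≤A′ = gatherHeaviest r A′ h′+r≡d in B , full , λ u → ≤-trans (B≤A′ u) (A′≤A u)
    where
      A′ : Assignment (suc m) d
      A′ = exchangeBalls A t a b
      h′+r≡d : heaviestInFirstBin A′ + r ≡ d
      h′+r≡d = trans (cong (_+ r) (exchange-countFirst-suc (ballType A) t a b y≡0 ind-x≡0))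
                     (trans (sym (+-suc _ r)) h+r≡d)
      A′≤A : TailNotHeavier A′ A
      A′≤A u = sumFin-mono-≤ d (exchange-lighter (ballType A) t a b w
                 (subst (λ z → w (ballType A Fin.zero b) ≤ w z) (sym y≡0) (w-anti _ _ z≤n)) u)

  collectHeaviest : (A : Assignment (suc m) d)
                  → Σ[ B ∈ Assignment (suc m) d ] heaviestInFirstBin B ≡ d × TailNotHeavier B A
  collectHeaviest A = gatherHeaviest (d ∸ heaviestInFirstBin A) A
    (m+[n∸m]≡n (sumFin≤n d (λ k → indicator≤1 (ballType A Fin.zero k) Fin.zero)))

feasible-suc⇔feasible-tail : ∀ k m d (C : Fin (suc m) → ℤ) (w : Fin (suc m) → ℕ) → NonIncreasingℕ w
                           → Feasible (suc k) (suc m) d C w ⇔ Feasible k m d (C ∘ Fin.suc) (w ∘ Fin.suc)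
feasible-suc⇔feasible-tail k m d C w w-anti = mk⇔ to from
  where
    to : Feasible (suc k) (suc m) d C w → Feasible k m d (C ∘ Fin.suc) (w ∘ Fin.suc)
    to (A , A-fits) =
      let B , full , B≤A = collectHeaviest w w-anti A
      in dropFirstBin B full , λ t k≤t →
           ℤ.≤-trans (ℤ.+≤+ (≤-trans (≤-reflexive (dropFirstBin-binWeight B full w t)) (B≤A t)))
                     (A-fits (Fin.suc t) (s≤s k≤t))

    from : Feasible k m d (C ∘ Fin.suc) (w ∘ Fin.suc) → Feasible (suc k) (suc m) d C w
    from (A , A-fits) = prependHeaviestBin A , λ where
      (Fin.suc t) (s≤s k≤t) → A-fits t k≤t

feasible-subst : ∀ {k m d} {C C′ : Fin m → ℤ} {w w′ : Fin m → ℕ}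
               → (∀ t → C t ≡ C′ t) → (∀ t → w t ≡ w′ t) → Feasible k m d C w → Feasible k m d C′ w′
feasible-subst {d = d} C≗C′ w≗w′ (A , A-fits) = A , λ t k≤t →
  subst₂ ℤ._≤_ (cong ℤ.+_ (sumFin-cong d (λ _ → w≗w′ _))) (C≗C′ t) (A-fits t k≤t)

feasible-cong : ∀ {k m d} {C C′ : Fin m → ℤ} {w w′ : Fin m → ℕ}
              → (∀ t → C t ≡ C′ t) → (∀ t → w t ≡ w′ t) → Feasible k m d C w ⇔ Feasible k m d C′ w′
feasible-cong C≗C′ w≗w′ = mk⇔ (feasible-subst C≗C′ w≗w′) (feasible-subst (sym ∘ C≗C′) (sym ∘ w≗w′))

toℕ-truncate : ∀ n i (1≤i : 1 ≤ i) (i≤n : i ≤ n) t → toℕ (truncate n i 1≤i i≤n id t) ≡ i ∸ 1 + toℕ t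
toℕ-truncate n i 1≤i i≤n t = toℕ-fromℕ< _

truncate-1 : ∀ {A : Set} n (1≤1 : 1 ≤ 1) (1≤n : 1 ≤ suc n) (x : Fin (suc n) → A) t
           → truncate (suc n) 1 1≤1 1≤n x t ≡ x t
truncate-1 n 1≤1 1≤n x t = cong x (toℕ-injective (toℕ-truncate (suc n) 1 1≤1 1≤n t))

truncate-suc : ∀ {A : Set} n i (1≤i : 1 ≤ suc (suc i)) (i≤n : suc i ≤ n) (x : Fin (suc n) → A) t
             → truncate (suc n) (suc (suc i)) 1≤i (s≤s i≤n) x t
               ≡ truncate n (suc i) (s≤s z≤n) i≤n (x ∘ Fin.suc) t
truncate-suc n i 1≤i i≤n x t = cong x (toℕ-injective (trans
  (toℕ-truncate (suc n) (suc (suc i)) 1≤i (s≤s i≤n) t)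
  (cong suc (sym (toℕ-truncate n (suc i) (s≤s z≤n) i≤n t)))))

NonIncreasingℕ-tail : ∀ {n} {w : Fin (suc n) → ℕ} → NonIncreasingℕ w → NonIncreasingℕ (w ∘ Fin.suc)
NonIncreasingℕ-tail w-anti s t s≤t = w-anti (Fin.suc s) (Fin.suc t) (s≤s s≤t)

feasible⇔feasible-truncate : ∀ n d (w : Fin n → ℕ) → NonIncreasingℕ w → (C : Fin n → ℤ)
                           → (i j : ℕ) (1≤i : 1 ≤ i) (i≤n : i ≤ n)
                           → Feasible (i + j ∸ 1) n d C w
                             ⇔ Feasible j (suc (n ∸ i)) d (truncate n i 1≤i i≤n C) (truncate n i 1≤i i≤n w)
feasible⇔feasible-truncate (suc n) d w w-anti C 1 j 1≤1 1≤n =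
  feasible-cong (sym ∘ truncate-1 n 1≤1 1≤n C) (sym ∘ truncate-1 n 1≤1 1≤n w)
feasible⇔feasible-truncate (suc n) d w w-anti C (suc (suc i)) j 1≤i (s≤s i≤n) =
  ⇔-trans (feasible-suc⇔feasible-tail (i + j) n d C w w-anti)
  (⇔-trans (feasible⇔feasible-truncate n d (w ∘ Fin.suc) (NonIncreasingℕ-tail w-anti) (C ∘ Fin.suc)
                                       (suc i) j (s≤s z≤n) i≤n)
           (feasible-cong (sym ∘ truncate-suc n i 1≤i i≤n C) (sym ∘ truncate-suc n i 1≤i i≤n w)))

lemma7p1 : (n d : ℕ) → 1 ≤ d → (w : Fin n → ℕ) → NonIncreasingℕ w
         → (C : Fin n → ℤ) → NonIncreasingℤ C
         → (i j : ℕ) → (1≤i : 1 ≤ i) → (i≤n : i ≤ n)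
         → Feasible (i + j ∸ 1) n d C w
           ⇔ Feasible j (suc (n ∸ i)) d (truncate n i 1≤i i≤n C) (truncate n i 1≤i i≤n w)
lemma7p1 n d _ w w-anti C _ = feasible⇔feasible-truncate n d w w-anti C
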